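{- For all integers $k,r\geq 2$, \[ f_r(k)\geq k^r. \]
   Context: An $r$-coloring of a set $A\subseteq\mathbb{N}$ is a function $\Delta:A\to\{0,1,\ldots,r-1\}$. For integers $r,k\geq 2$, $f_r(k)$ denotes the smallest positive integer $n$ such that every $r$-coloring $\Delta$ of $\{1,2,\ldots,n\}$ has a monochromatic solution to $1/x_1+\cdots+1/x_k=1/y$, i.e. elements $a_1,\ldots,a_k,b$ (with $a_1,\ldots,a_k$ not necessarily distinct) with $1/a_1+\cdots+1/a_k=1/b$ and $\Delta(a_1)=\cdots=\Delta(a_k)=\Delta(b)$. -}

module Defs where

open import Data.Nat using (ℕ; zero; suc; _≤_)
open import Data.Fin using (Fin)
open import Data.Integer using (+_)
open import Data.Rational using (ℚ; _/_; 0ℚ; _+_)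
open import Data.Product using (Σ; _×_)
open import Relation.Binary.PropositionalEquality using (_≡_)

-- reciprocal of a natural number as a rational; only ever applied to a ≥ 1
recip : ℕ → ℚ
recip zero    = 0ℚ
recip (suc m) = (+ 1) / suc m

sumRecip : (k : ℕ) → (Fin k → ℕ) → ℚ
sumRecip zero    a = 0ℚ
sumRecip (suc k) a = recip (a Fin.zero) + sumRecip k (λ i → a (Fin.suc i))

InRange : ℕ → ℕ → Set
InRange n x = (1 ≤ x) × (x ≤ n)

-- An r-coloring of {1,…,n}: only its values on {1,…,n} matter.
Coloring : ℕ → Set
Coloring r = ℕ → Fin r

HasMonoSolution : (r k n : ℕ) → Coloring r → Set
HasMonoSolution r k n Δ =
  Σ (Fin k → ℕ) λ a → Σ ℕ λ b →
    ((i : Fin k) → InRange n (a i)) × InRange n b ×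
    ((i : Fin k) → Δ (a i) ≡ Δ b) ×
    (sumRecip k a ≡ recip b)

-- every r-coloring of {1,…,n} has a monochromatic solution
-- (f_r(k) is the least positive n with this property)
Property : (r k n : ℕ) → Set
Property r k n = (Δ : Coloring r) → HasMonoSolution r k n Δ

module Submission where

-- Color x ∈ {1,…,n} by ⌊log_k x⌋. When n < k^r this uses at most r colors, and two
-- numbers of the same color lie in one interval [k^j, k^(j+1)), so they differ by a
-- factor less than k. In a monochromatic solution every a_i is then less than k·b, so
-- 1/a_1 + ⋯ + 1/a_k > k · 1/(k b) = 1/b.

open import Defs
open import Data.Fin using (Fin; fromℕ<)

module ReciprocalSums where
  open import Data.Nat as ℕ using (ℕ; zero; suc; s≤s; z≤n)
  open import Data.Nat.Properties using (≤-pred)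
  open import Data.Integer as ℤ using (ℤ; +_; +<+; +≤+)
  open import Data.Integer.Properties using (*-identityˡ)
  open import Data.Integer.Tactic.RingSolver using (solve-∀)
  open import Data.Rational as ℚ using (toℚᵘ)
  open import Data.Rational.Properties using (toℚᵘ-fromℚᵘ; toℚᵘ-cong; toℚᵘ-homo-+)
  open import Data.Rational.Unnormalised using (_/_; _+_; _≃_; _≤_; _<_; *≡*; *≤*; *<*)
  open import Data.Rational.Unnormalised.Properties
    using (<⇒≤; <-irrefl; +-mono-<-≤; module ≤-Reasoning)
  open import Data.Product using (_×_; _,_; proj₁; proj₂)
  open import Relation.Binary.PropositionalEquality using (_≡_; _≢_; sym)

  toℚᵘ-recip : ∀ c → toℚᵘ (recip (suc c)) ≃ + 1 / suc c
  toℚᵘ-recip c = toℚᵘ-fromℚᵘ (+ 1 / suc c)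

  [1+m]/d≃1/d+m/d : ∀ m d → + suc m / suc d ≃ + 1 / suc d + + m / suc d
  [1+m]/d≃1/d+m/d m d = *≡* (identity (+ suc d) (+ m))
    where
    identity : ∀ (e n : ℤ) → (+ 1 ℤ.+ n) ℤ.* (e ℤ.* e) ≡ (+ 1 ℤ.* e ℤ.+ n ℤ.* e) ℤ.* e
    identity = solve-∀

  1/d<recip : ∀ {c d} → c ℕ.< d → + 1 / suc d < toℚᵘ (recip (suc c))
  1/d<recip {c} {d} c<d = begin-strict
    + 1 / suc d          <⟨ *<* cross-multiplied ⟩
    + 1 / suc c          ≃⟨ toℚᵘ-recip c ⟨
    toℚᵘ (recip (suc c)) ∎
    where
    open ≤-Reasoning
    cross-multiplied : + 1 ℤ.* + suc c ℤ.< + 1 ℤ.* + suc d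
    cross-multiplied rewrite *-identityˡ (+ suc c) | *-identityˡ (+ suc d) = +<+ (s≤s c<d)

  mutual
    sumRecip-≥ : ∀ d m (a : Fin m → ℕ) → (∀ i → InRange d (a i)) →
      + m / suc d ≤ toℚᵘ (sumRecip m a)
    sumRecip-≥ d zero    a a∈ = *≤* (+≤+ z≤n)
    sumRecip-≥ d (suc m) a a∈ = <⇒≤ (sumRecip-> d m a a∈)

    sumRecip-> : ∀ d m (a : Fin (suc m) → ℕ) → (∀ i → InRange d (a i)) →
      + suc m / suc d < toℚᵘ (sumRecip (suc m) a)
    sumRecip-> d m a a∈ with a Fin.zero | a∈ Fin.zero
    ... | suc c | _ , c<d = begin-strict
      + suc m / suc d                               ≃⟨ [1+m]/d≃1/d+m/d m d ⟩
      + 1 / suc d + + m / suc d                     <⟨ +-mono-<-≤ (1/d<recip c<d) (sumRecip-≥ d m tail (λ i → a∈ (Fin.suc i))) ⟩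
      toℚᵘ (recip (suc c)) + toℚᵘ (sumRecip m tail) ≃⟨ toℚᵘ-homo-+ (recip (suc c)) (sumRecip m tail) ⟨
      toℚᵘ (recip (suc c) ℚ.+ sumRecip m tail)      ∎
      where
      open ≤-Reasoning
      tail : Fin m → ℕ
      tail i = a (Fin.suc i)

  sumRecip≢recip : ∀ k b (a : Fin (suc k) → ℕ) →
    (∀ i → 1 ℕ.≤ a i × a i ℕ.< suc k ℕ.* suc b) → sumRecip (suc k) a ≢ recip (suc b)
  sumRecip≢recip k b a a-bounds sum≡recip = <-irrefl k/kb≃1/b (begin-strict
    + suc k / (suc k ℕ.* suc b) <⟨ sumRecip-> _ k a a∈ ⟩
    toℚᵘ (sumRecip (suc k) a)   ≃⟨ toℚᵘ-cong sum≡recip ⟩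
    toℚᵘ (recip (suc b))        ≃⟨ toℚᵘ-recip b ⟩
    + 1 / suc b                 ∎)
    where
    open ≤-Reasoning
    a∈ : ∀ i → InRange (b ℕ.+ k ℕ.* suc b) (a i)
    a∈ i = proj₁ (a-bounds i) , ≤-pred (proj₂ (a-bounds i))
    k/kb≃1/b : + suc k / (suc k ℕ.* suc b) ≃ + 1 / suc b
    k/kb≃1/b = *≡* (sym (*-identityˡ _))

open ReciprocalSums using (sumRecip≢recip)

open import Data.Nat as ℕ using (ℕ; zero; suc; _≤_; _<_; _^_; _*_; s≤s; z≤n; _≤?_)
open import Data.Nat.Properties
  using (≤-refl; m≤n⇒m≤1+n; ≰⇒>; ≤-<-trans; *-monoʳ-≤; module ≤-Reasoning)
open import Data.Fin.Properties using (fromℕ<-injective)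
open import Data.Product using (_×_; _,_; proj₁; proj₂)
open import Data.Empty using (⊥-elim)
open import Relation.Nullary using (¬_; yes; no)
open import Relation.Binary.PropositionalEquality using (_≡_; cong)

level : ℕ → ℕ → ℕ → ℕ
level k zero    x = 0
level k (suc m) x with k ^ suc m ≤? x
... | yes _ = suc m
... | no  _ = level k m x

level≤ : ∀ k m x → level k m x ≤ m
level≤ k zero    x = z≤n
level≤ k (suc m) x with k ^ suc m ≤? x
... | yes _ = ≤-refl
... | no  _ = m≤n⇒m≤1+n (level≤ k m x)

^level≤ : ∀ k m x → 1 ≤ x → k ^ level k m x ≤ x
^level≤ k zero    x 1≤x = 1≤x
^level≤ k (suc m) x 1≤x with k ^ suc m ≤? x
... | yes k^m≤x = k^m≤x
... | no  _     = ^level≤ k m x 1≤x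

<^suc-level : ∀ k m x → x < k ^ suc m → x < k ^ suc (level k m x)
<^suc-level k zero    x x<k = x<k
<^suc-level k (suc m) x x<k^m with k ^ suc m ≤? x
... | yes _     = x<k^m
... | no  k^m≰x = <^suc-level k m x (≰⇒> k^m≰x)

levelColoring : ℕ → (m : ℕ) → Coloring (suc m)
levelColoring k m x = fromℕ< (s≤s (level≤ k m x))

sameColor⇒<* : ∀ k m x y → 1 ≤ y → x < k ^ suc m →
  levelColoring k m x ≡ levelColoring k m y → x < k * y
sameColor⇒<* k m x y 1≤y x<k^m same-color = begin-strict
  x                   <⟨ <^suc-level k m x x<k^m ⟩
  k * k ^ level k m x ≡⟨ cong (λ j → k * k ^ j) same-level ⟩
  k * k ^ level k m y ≤⟨ *-monoʳ-≤ k (^level≤ k m y 1≤y) ⟩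
  k * y               ∎
  where
  open ≤-Reasoning
  same-level : level k m x ≡ level k m y
  same-level = fromℕ<-injective _ _ _ _ same-color

levelColoring-noMonoSolution : ∀ k r n → n < suc k ^ suc r →
  ¬ HasMonoSolution (suc r) (suc k) n (levelColoring (suc k) r)
levelColoring-noMonoSolution k r n n<k^r (a , zero , _ , (() , _) , _)
levelColoring-noMonoSolution k r n n<k^r (a , suc b , a∈ , _ , same-color , sum≡recip) =
  sumRecip≢recip k b a a-bounds sum≡recip
  where
  a-bounds : ∀ i → 1 ≤ a i × a i < suc k * suc b
  a-bounds i = proj₁ (a∈ i) ,
    sameColor⇒<* (suc k) r (a i) (suc b) (s≤s z≤n) (≤-<-trans (proj₂ (a∈ i)) n<k^r) (same-color i)

theorem5p3 : (k r : ℕ) → 2 ≤ k → 2 ≤ r →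
    (n : ℕ) → 1 ≤ n → Property r k n → k ^ r ≤ n
theorem5p3 (suc k) (suc r) _ _ n _ every-coloring-has-solution with suc k ^ suc r ≤? n
... | yes k^r≤n = k^r≤n
... | no  k^r≰n = ⊥-elim (levelColoring-noMonoSolution k r n (≰⇒> k^r≰n)
                            (every-coloring-has-solution (levelColoring (suc k) r)))
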